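{- Let $\mathcal{C}$ be a regular category with terminal object $\mathbf{1}$, let $n \ge 0$, and let \[ A = A_0 \xrightarrow{R_1} A_1 \xrightarrow{R_2} \cdots \xrightarrow{R_n} A_n \xrightarrow{R_{n+1}} A_{n+1} = A \] be a belief cycle, i.e. relations $R_k \rightarrowtail A_{k-1} \times A_k$ for $k = 1, \dots, n+1$. Suppose that for every subobject $p \rightarrowtail A$ there is a global element $c : \mathbf{1} \to A$ such that \[ c \models \Box_1 \cdots \Box_n \boxplus_{n+1} p \;\wedge\; \Diamond_1 \top \wedge \Box_1 \Diamond_2 \top \wedge \cdots \wedge \Box_1 \cdots \Box_{n-1} \Diamond_n \top, \] i.e., writing $y_0 := c$ and using variables $y_k : A_k$ ($1 \le k \le n$), $x : A$, the following regular sequents are valid: (a) $R_1(y_0, y_1) \wedge \cdots \wedge R_n(y_{n-1}, y_n) \wedge R_{n+1}(y_n, x) \vdash p(x)$; (b) $R_1(y_0, y_1) \wedge \cdots \wedge R_n(y_{n-1}, y_n) \wedge p(x) \vdash R_{n+1}(y_n, x)$; (c) for each $k = 1, \dots, n$: $R_1(y_0, y_1) \wedge \cdots \wedge R_{k-1}(y_{k-2}, y_{k-1}) \vdash \exists y_k.\, R_k(y_{k-1}, y_k)$. Let $R = R_1 ; \cdots ; R_{n+1} \rightarrowtail A \times A$ be the relational composite, $R(x_0, x) \equiv \exists y_1 \cdots \exists y_n.\,[R_1(x_0,y_1) \wedge \cdots \wedge R_{n+1}(y_n, x)]$. Then $R$ is very weakly point surjective.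
   Context: A regular category is a well-powered category with finite limits and pullback-stable images; regular logic (conjunction, $\exists$, substitution) is interpreted in it via subobjects, with sequent $\phi \vdash \psi$ valid when $[\![\phi]\!] \le [\![\psi]\!]$ (sequents are understood over all their free variables). Modalities: for a relation $R_k$, $y \models \Box_k \phi$ iff $\forall z.\, R_k(y,z) \Rightarrow z \models \phi$; $y \models \Diamond_k \phi$ iff $\exists z.\, R_k(y,z) \wedge z \models \phi$; $y \models \boxplus_k \phi$ iff $\forall z.\, R_k(y,z) \Leftrightarrow z \models \phi$. A relation $R \rightarrowtail A \times A$ is very weakly point surjective if for every subobject $P \rightarrowtail A$ there is $c : \mathbf{1} \to A$ with $\langle c, c\rangle^*(R) = c^*(P)$ in $\mathsf{Sub}(\mathbf{1})$. -}

module Defs where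

open import Level using (Level; _⊔_; Lift) renaming (suc to lsuc)
open import Data.Nat using (ℕ; zero; suc)
open import Data.Unit using (⊤)
open import Data.Product using (Σ; _,_; proj₁; proj₂) renaming (_×_ to _∧ₜ_)
open import Relation.Binary using (Rel; IsEquivalence)

record Category (o ℓ e : Level) : Set (lsuc (o ⊔ ℓ ⊔ e)) where
  infixr 9 _∘_
  infix  4 _≈_
  infix  5 _⇒_
  field
    Obj   : Set o
    _⇒_   : Obj → Obj → Set ℓ
    _≈_   : ∀ {A B} → Rel (A ⇒ B) e
    id    : ∀ {A} → A ⇒ A
    _∘_   : ∀ {A B C} → B ⇒ C → A ⇒ B → A ⇒ C
    ≈-equiv   : ∀ {A B} → IsEquivalence (_≈_ {A} {B})
    ∘-resp-≈  : ∀ {A B C} {f h : B ⇒ C} {g i : A ⇒ B} → f ≈ h → g ≈ i → f ∘ g ≈ h ∘ i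
    assoc     : ∀ {A B C D} {f : A ⇒ B} {g : B ⇒ C} {h : C ⇒ D} → (h ∘ g) ∘ f ≈ h ∘ (g ∘ f)
    identityˡ : ∀ {A B} {f : A ⇒ B} → id ∘ f ≈ f
    identityʳ : ∀ {A B} {f : A ⇒ B} → f ∘ id ≈ f

module CatNotions {o ℓ e : Level} (C : Category o ℓ e) where
  open Category C

  Mono : ∀ {S X} → S ⇒ X → Set (o ⊔ ℓ ⊔ e)
  Mono {S} m = ∀ {Z} (g h : Z ⇒ S) → m ∘ g ≈ m ∘ h → g ≈ h

  record Sub (X : Obj) : Set (o ⊔ ℓ ⊔ e) where
    constructor sub
    field
      dom  : Obj
      arr  : dom ⇒ X
      mono : Mono arr
  open Sub public

  infix 4 _≤_
  _≤_ : ∀ {X} → Sub X → Sub X → Set (ℓ ⊔ e)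
  P ≤ Q = Σ (dom P ⇒ dom Q) λ h → arr Q ∘ h ≈ arr P

record IsRegular {o ℓ e : Level} (C : Category o ℓ e) : Set (lsuc ℓ ⊔ o ⊔ e) where
  open Category C
  open CatNotions C
  infixr 7 _×_
  field
    𝟏        : Obj
    !        : ∀ {A} → A ⇒ 𝟏
    !-unique : ∀ {A} (f : A ⇒ 𝟏) → f ≈ !
    _×_      : Obj → Obj → Obj
    π₁       : ∀ {A B} → A × B ⇒ A
    π₂       : ∀ {A B} → A × B ⇒ B
    ⟨_,_⟩    : ∀ {X A B} → X ⇒ A → X ⇒ B → X ⇒ A × B
    project₁ : ∀ {X A B} {f : X ⇒ A} {g : X ⇒ B} → π₁ ∘ ⟨ f , g ⟩ ≈ f
    project₂ : ∀ {X A B} {f : X ⇒ A} {g : X ⇒ B} → π₂ ∘ ⟨ f , g ⟩ ≈ g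
    ⟨⟩-unique : ∀ {X A B} {f : X ⇒ A} {g : X ⇒ B} {h : X ⇒ A × B} →
                π₁ ∘ h ≈ f → π₂ ∘ h ≈ g → h ≈ ⟨ f , g ⟩
    Pb       : ∀ {A B Z} → A ⇒ Z → B ⇒ Z → Obj
    p₁       : ∀ {A B Z} {f : A ⇒ Z} {g : B ⇒ Z} → Pb f g ⇒ A
    p₂       : ∀ {A B Z} {f : A ⇒ Z} {g : B ⇒ Z} → Pb f g ⇒ B
    pb-commute : ∀ {A B Z} {f : A ⇒ Z} {g : B ⇒ Z} → f ∘ p₁ {f = f} {g} ≈ g ∘ p₂ {f = f} {g}
    pb-univ  : ∀ {A B Z X} {f : A ⇒ Z} {g : B ⇒ Z} (h : X ⇒ A) (k : X ⇒ B) →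
               f ∘ h ≈ g ∘ k → X ⇒ Pb f g
    pb-univ₁ : ∀ {A B Z X} {f : A ⇒ Z} {g : B ⇒ Z} {h : X ⇒ A} {k : X ⇒ B}
               (eq : f ∘ h ≈ g ∘ k) → p₁ {f = f} {g} ∘ pb-univ h k eq ≈ h
    pb-univ₂ : ∀ {A B Z X} {f : A ⇒ Z} {g : B ⇒ Z} {h : X ⇒ A} {k : X ⇒ B}
               (eq : f ∘ h ≈ g ∘ k) → p₂ {f = f} {g} ∘ pb-univ h k eq ≈ k
    pb-unique : ∀ {A B Z X} {f : A ⇒ Z} {g : B ⇒ Z} {h : X ⇒ A} {k : X ⇒ B}
                (eq : f ∘ h ≈ g ∘ k) (u : X ⇒ Pb f g) →
                p₁ {f = f} {g} ∘ u ≈ h → p₂ {f = f} {g} ∘ u ≈ k → u ≈ pb-univ h k eq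
    Im       : ∀ {A B} → A ⇒ B → Obj
    im       : ∀ {A B} (f : A ⇒ B) → Im f ⇒ B
    im-mono  : ∀ {A B} (f : A ⇒ B) → Mono (im f)
    cover    : ∀ {A B} (f : A ⇒ B) → A ⇒ Im f
    im-factor : ∀ {A B} (f : A ⇒ B) → im f ∘ cover f ≈ f
    im-least : ∀ {A B X} (f : A ⇒ B) (m : X ⇒ B) → Mono m → (g : A ⇒ X) → m ∘ g ≈ f →
               Σ (Im f ⇒ X) λ h → m ∘ h ≈ im f
    -- pullback-stability of images: for f : A ⇒ B and u : Y ⇒ B, the pullback
    -- u*(im f) is contained in (hence equal to) the image of the pullback of f along u
    im-stable : ∀ {A B Y} (f : A ⇒ B) (u : Y ⇒ B) →
                Σ (Pb (im f) u ⇒ Im (p₂ {f = f} {u})) λ h →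
                  im (p₂ {f = f} {u}) ∘ h ≈ p₂ {f = im f} {u}
    well-powered : ∀ X → Σ (Set ℓ) λ I → Σ (I → Sub X) λ fam →
                   (P : Sub X) → Σ I λ i → (P ≤ fam i) ∧ₜ (fam i ≤ P)

record RegularCategory (o ℓ e : Level) : Set (lsuc (o ⊔ ℓ ⊔ e)) where
  field
    cat     : Category o ℓ e
    regular : IsRegular cat
  open Category cat public
  open CatNotions cat public
  open IsRegular regular public

module RegularLogic {o ℓ e : Level} (𝒞 : RegularCategory o ℓ e) where
  open RegularCategory 𝒞

  image : ∀ {S X} → S ⇒ X → Sub X
  image f = sub (Im f) (im f) (im-mono f)

  ⊤ₛ : ∀ {X} → Sub X
  ⊤ₛ = image id

  _* : ∀ {Y X} → Y ⇒ X → Sub X → Sub Y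
  (u *) P = image (p₂ {f = arr P} {u})

  infixr 6 _∧_
  _∧_ : ∀ {X} → Sub X → Sub X → Sub X
  P ∧ Q = image (arr P ∘ p₁ {f = arr P} {arr Q})

  ∃⟨_⟩ : ∀ {X Y} → X ⇒ Y → Sub X → Sub Y
  ∃⟨ f ⟩ P = image (f ∘ arr P)

  infix 4 _≅_
  _≅_ : ∀ {X} → Sub X → Sub X → Set (ℓ ⊔ e)
  P ≅ Q = (P ≤ Q) ∧ₜ (Q ≤ P)

  data Chain (X : Obj) : ℕ → Set (o ⊔ ℓ ⊔ e) where
    []  : Chain X zero
    _◁_ : ∀ {Y n} → Sub (X × Y) → Chain Y n → Chain X (suc n)

  end : ∀ {X n} → Chain X n → Obj
  end {X} []           = X
  end (_◁_ {Y} R ch)   = end ch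

  -- Given a context Γ with hypothesis φ and a term t : Γ ⇒ A₀ standing for y₀,
  -- extend the context by variables y₁ : A₁, …, yₙ : Aₙ and the hypothesis by
  -- R₁(y₀,y₁) ∧ ⋯ ∧ Rₙ(yₙ₋₁,yₙ).
  record Ext (Γ : Obj) (Z : Obj) : Set (o ⊔ ℓ ⊔ e) where
    field
      ctx  : Obj
      wk   : ctx ⇒ Γ
      hyp  : Sub ctx
      last : ctx ⇒ Z
  open Ext public

  extend : ∀ {Γ X n} → Sub Γ → Γ ⇒ X → (ch : Chain X n) → Ext Γ (end ch)
  extend {Γ} φ t [] = record { ctx = Γ ; wk = id ; hyp = φ ; last = t }
  extend {Γ} φ t (_◁_ {Y} R ch) =
    let r = extend {Γ × Y} ((π₁ *) φ ∧ (⟨ t ∘ π₁ , π₂ ⟩ *) R) π₂ ch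
    in record { ctx = ctx r ; wk = π₁ ∘ wk r ; hyp = hyp r ; last = last r }

  -- condition (c): in context Γ with hypothesis φ and current variable t,
  -- for each k:  R₁(y₀,y₁) ∧ ⋯ ∧ R_{k-1}(y_{k-2},y_{k-1}) ⊢ ∃ y_k. R_k(y_{k-1},y_k),
  -- each sequent in the context of exactly its free variables y₁,…,y_{k-1}.
  Serial : ∀ {Γ X n} → Sub Γ → Γ ⇒ X → Chain X n → Set (ℓ ⊔ e)
  Serial φ t [] = Lift _ ⊤
  Serial {Γ} φ t (_◁_ {Y} R ch) =
    (φ ≤ ∃⟨ π₁ {Γ} {Y} ⟩ ((⟨ t ∘ π₁ , π₂ ⟩ *) R))
    ∧ₜ Serial {Γ × Y} ((π₁ *) φ ∧ (⟨ t ∘ π₁ , π₂ ⟩ *) R) π₂ ch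

  BeliefHyp : ∀ {A n} (ch : Chain A n) → Sub (end ch × A) → Sub A → 𝟏 ⇒ A → Set (ℓ ⊔ e)
  BeliefHyp {A} ch Rlast p c =
    let F   = extend {𝟏} ⊤ₛ c ch
        Φ   = (π₁ {ctx F} {A} *) (hyp F)                  -- R₁(c,y₁) ∧ ⋯ ∧ Rₙ(yₙ₋₁,yₙ)
        Rn₁ = (⟨ last F ∘ π₁ , π₂ ⟩ *) Rlast               -- Rₙ₊₁(yₙ,x)
        px  = (π₂ {ctx F} {A} *) p                         -- p(x)
    in (Φ ∧ Rn₁ ≤ px) ∧ₜ (Φ ∧ px ≤ Rn₁) ∧ₜ Serial {𝟏} ⊤ₛ c ch

  composite : ∀ {A n} (ch : Chain A n) → Sub (end ch × A) → Sub (A × A)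
  composite {A} ch Rlast =
    let G = extend {A} ⊤ₛ id ch
    in ∃⟨ ⟨ wk G ∘ π₁ , π₂ ⟩ ⟩
         ((π₁ {ctx G} {A} *) (hyp G) ∧ (⟨ last G ∘ π₁ , π₂ ⟩ *) Rlast)

  VeryWeaklyPointSurjective : ∀ {A} → Sub (A × A) → Set (o ⊔ ℓ ⊔ e)
  VeryWeaklyPointSurjective {A} R =
    (P : Sub A) → Σ (𝟏 ⇒ A) λ c → (⟨ c , c ⟩ *) R ≅ (c *) P

  -- The statement of the lemma for a given belief cycle
  -- A = A₀ →R₁ ⋯ →Rₙ Aₙ →Rₙ₊₁ A  (ch = R₁…Rₙ, Rlast = Rₙ₊₁).
  Lemma8Statement : ∀ {A n} (ch : Chain A n) → Sub (end ch × A) → Set (o ⊔ ℓ ⊔ e)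
  Lemma8Statement {A} ch Rlast =
    ((p : Sub A) → Σ (𝟏 ⇒ A) λ c → BeliefHyp ch Rlast p c) →
    VeryWeaklyPointSurjective (composite ch Rlast)

-- Reason in the internal logic through generalised elements x : W ⇒ X, with
-- "x ∈ S" meaning that x factors through S. In a regular category an element
-- of an image lifts after passing to a cover, and membership descends along
-- covers. So R(c,c) holds at a stage iff, locally, there is a path
-- c R₁ y₁ R₂ ⋯ Rₙ yₙ with Rₙ₊₁(yₙ, c). Given R(c,c), sequent (a) yields p(c).
-- Given p(c), the seriality sequents (c) produce such a path from c locally,
-- sequent (b) relates its end to c, and descent gives R(c,c).

module Submission where

open import Defs
open import Level using (Level; _⊔_)
open import Data.Nat using (ℕ)
open import Data.Product using (Σ; _,_; proj₂) renaming (_×_ to _∧ₜ_)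
open import Relation.Binary using (IsEquivalence)

module GeneralisedElements {o ℓ e : Level} (𝒞 : RegularCategory o ℓ e) where
  open RegularCategory 𝒞
  open RegularLogic 𝒞

  module ≈ {A B} = IsEquivalence (≈-equiv {A} {B})

  infixr 5 _⊙_
  _⊙_ : ∀ {A B} {f g h : A ⇒ B} → f ≈ g → g ≈ h → f ≈ h
  _⊙_ = ≈.trans

  ∘-resp-≈ˡ : ∀ {A B C} {f h : B ⇒ C} {g : A ⇒ B} → f ≈ h → f ∘ g ≈ h ∘ g
  ∘-resp-≈ˡ p = ∘-resp-≈ p ≈.refl

  ∘-resp-≈ʳ : ∀ {A B C} {f : B ⇒ C} {g i : A ⇒ B} → g ≈ i → f ∘ g ≈ f ∘ i
  ∘-resp-≈ʳ p = ∘-resp-≈ ≈.refl p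

  sym-assoc : ∀ {A B C D} {f : A ⇒ B} {g : B ⇒ C} {h : C ⇒ D} → h ∘ (g ∘ f) ≈ (h ∘ g) ∘ f
  sym-assoc = ≈.sym assoc

  ⟨⟩∘ : ∀ {X Y A B} {f : X ⇒ A} {g : X ⇒ B} {h : Y ⇒ X} → ⟨ f , g ⟩ ∘ h ≈ ⟨ f ∘ h , g ∘ h ⟩
  ⟨⟩∘ = ⟨⟩-unique (sym-assoc ⊙ ∘-resp-≈ˡ project₁) (sym-assoc ⊙ ∘-resp-≈ˡ project₂)

  ⟨⟩-cong : ∀ {X A B} {f f′ : X ⇒ A} {g g′ : X ⇒ B} → f ≈ f′ → g ≈ g′ → ⟨ f , g ⟩ ≈ ⟨ f′ , g′ ⟩
  ⟨⟩-cong p q = ⟨⟩-unique (project₁ ⊙ p) (project₂ ⊙ q)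

  ∘π₁-⟨⟩ : ∀ {X A B C} {f : A ⇒ C} {a : X ⇒ A} {b : X ⇒ B} → (f ∘ π₁) ∘ ⟨ a , b ⟩ ≈ f ∘ a
  ∘π₁-⟨⟩ = assoc ⊙ ∘-resp-≈ʳ project₁

  first∘⟨⟩ : ∀ {X A A′ B} {f : A ⇒ A′} {a : X ⇒ A} {b : X ⇒ B} →
             ⟨ f ∘ π₁ , π₂ ⟩ ∘ ⟨ a , b ⟩ ≈ ⟨ f ∘ a , b ⟩
  first∘⟨⟩ = ⟨⟩∘ ⊙ ⟨⟩-cong ∘π₁-⟨⟩ project₂

  ⟨⟩∘-components : ∀ {V W X A B} {f : V ⇒ A} {g : V ⇒ B} {a : X ⇒ A} {b : X ⇒ B}
                   {v : W ⇒ V} {q : W ⇒ X} →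
                   ⟨ f , g ⟩ ∘ v ≈ ⟨ a , b ⟩ ∘ q → (f ∘ v ≈ a ∘ q) ∧ₜ (g ∘ v ≈ b ∘ q)
  ⟨⟩∘-components eq =
      (∘-resp-≈ˡ (≈.sym project₁) ⊙ assoc ⊙ ∘-resp-≈ʳ eq ⊙ sym-assoc ⊙ ∘-resp-≈ˡ project₁)
    , (∘-resp-≈ˡ (≈.sym project₂) ⊙ assoc ⊙ ∘-resp-≈ʳ eq ⊙ sym-assoc ⊙ ∘-resp-≈ˡ project₂)

  p₂-mono : ∀ {A B Z} {m : A ⇒ Z} {u : B ⇒ Z} → Mono m → Mono (p₂ {f = m} {u})
  p₂-mono {m = m} {u} m-mono g h eq =
    pb-unique E g ≈.refl ≈.refl ⊙ ≈.sym (pb-unique E h p₁-agree (≈.sym eq))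
    where
      E : m ∘ (p₁ {f = m} {u} ∘ g) ≈ u ∘ (p₂ {f = m} {u} ∘ g)
      E = sym-assoc ⊙ ∘-resp-≈ˡ pb-commute ⊙ assoc
      p₁-agree : p₁ {f = m} {u} ∘ h ≈ p₁ ∘ g
      p₁-agree = m-mono _ _ (sym-assoc ⊙ ∘-resp-≈ˡ pb-commute ⊙ assoc ⊙ ∘-resp-≈ʳ (≈.sym eq)
                             ⊙ sym-assoc ⊙ ∘-resp-≈ˡ (≈.sym pb-commute) ⊙ assoc)

  infix 4 _∈_
  record _∈_ {W X} (x : W ⇒ X) (S : Sub X) : Set (ℓ ⊔ e) where
    constructor mem
    field
      through  : W ⇒ dom S
      commutes : arr S ∘ through ≈ x

  ∈-resp-≈ : ∀ {W X} {x x′ : W ⇒ X} {S : Sub X} → x ≈ x′ → x ∈ S → x′ ∈ S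
  ∈-resp-≈ eq (mem h p) = mem h (p ⊙ eq)

  ∈-∘ : ∀ {V W X} {x : W ⇒ X} {S : Sub X} → x ∈ S → (q : V ⇒ W) → x ∘ q ∈ S
  ∈-∘ (mem h p) q = mem (h ∘ q) (sym-assoc ⊙ ∘-resp-≈ˡ p)

  ∈-≤ : ∀ {W X} {x : W ⇒ X} {S T : Sub X} → x ∈ S → S ≤ T → x ∈ T
  ∈-≤ (mem h p) (k , q) = mem (k ∘ h) (sym-assoc ⊙ ∘-resp-≈ˡ q ⊙ p)

  arr-∈ : ∀ {X} (S : Sub X) → arr S ∈ S
  arr-∈ S = mem id identityʳ

  ≤-intro : ∀ {X} {S T : Sub X} → (∀ {W} {x : W ⇒ X} → x ∈ S → x ∈ T) → S ≤ T
  ≤-intro {S = S} S⊆T with S⊆T (arr-∈ S)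
  ... | mem h p = h , p

  image-intro : ∀ {S X W} (f : S ⇒ X) (h : W ⇒ S) → f ∘ h ∈ image f
  image-intro f h = mem (cover f ∘ h) (sym-assoc ⊙ ∘-resp-≈ˡ (im-factor f))

  image-least : ∀ {S X W} (f : S ⇒ X) (T : Sub X) (g : S ⇒ dom T) → arr T ∘ g ≈ f →
                {x : W ⇒ X} → x ∈ image f → x ∈ T
  image-least f T g eq (mem h q) =
    let k , p = im-least f (arr T) (mono T) g eq
    in mem (k ∘ h) (sym-assoc ⊙ ∘-resp-≈ˡ p ⊙ q)

  ⊤-intro : ∀ {W X} {x : W ⇒ X} → x ∈ ⊤ₛ
  ⊤-intro {x = x} = ∈-resp-≈ identityˡ (image-intro id x)

  ∧-intro : ∀ {W X} {P Q : Sub X} {x : W ⇒ X} → x ∈ P → x ∈ Q → x ∈ P ∧ Q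
  ∧-intro {P = P} {Q} (mem h p) (mem k q) =
    ∈-resp-≈ (assoc ⊙ ∘-resp-≈ʳ (pb-univ₁ E) ⊙ p)
      (image-intro (arr P ∘ p₁ {f = arr P} {arr Q}) (pb-univ h k E))
    where
      E : arr P ∘ h ≈ arr Q ∘ k
      E = p ⊙ ≈.sym q

  ∧-elim₁ : ∀ {W X} {P Q : Sub X} {x : W ⇒ X} → x ∈ P ∧ Q → x ∈ P
  ∧-elim₁ {P = P} {Q} = image-least (arr P ∘ p₁ {f = arr P} {arr Q}) P p₁ ≈.refl

  ∧-elim₂ : ∀ {W X} {P Q : Sub X} {x : W ⇒ X} → x ∈ P ∧ Q → x ∈ Q
  ∧-elim₂ {P = P} {Q} = image-least (arr P ∘ p₁ {f = arr P} {arr Q}) Q p₂ (≈.sym pb-commute)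

  *-intro : ∀ {W Y X} {u : Y ⇒ X} {P : Sub X} {x : W ⇒ Y} → u ∘ x ∈ P → x ∈ (u *) P
  *-intro {u = u} {P} {x} (mem h p) =
    ∈-resp-≈ (pb-univ₂ p) (image-intro (p₂ {f = arr P} {u}) (pb-univ h x p))

  *-elim : ∀ {W Y X} {u : Y ⇒ X} {P : Sub X} {x : W ⇒ Y} → x ∈ (u *) P → u ∘ x ∈ P
  *-elim {u = u} {P} x∈ =
    let mem h q = image-least (p₂ {f = arr P} {u}) (sub _ p₂ (p₂-mono (mono P))) id identityʳ x∈
    in mem (p₁ {f = arr P} {u} ∘ h) (sym-assoc ⊙ ∘-resp-≈ˡ pb-commute ⊙ assoc ⊙ ∘-resp-≈ʳ q)

  ∃-intro : ∀ {W X Y} (f : X ⇒ Y) {P : Sub X} {x : W ⇒ X} → x ∈ P → f ∘ x ∈ ∃⟨ f ⟩ P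
  ∃-intro f {P} (mem h p) = ∈-resp-≈ (assoc ⊙ ∘-resp-≈ʳ p) (image-intro (f ∘ arr P) h)

  Cover : ∀ {V W} → V ⇒ W → Set (ℓ ⊔ e)
  Cover q = id ∈ image q

  descend : ∀ {V W X} {q : V ⇒ W} → Cover q → (T : Sub X) {x : W ⇒ X} → x ∘ q ∈ T → x ∈ T
  descend {q = q} (mem s s-section) T {x} (mem g g-eq) =
    let k , k-eq = im-least q (p₂ {f = arr T} {x}) (p₂-mono (mono T))
                            (pb-univ g q g-eq) (pb-univ₂ g-eq)
    in mem (p₁ {f = arr T} {x} ∘ (k ∘ s))
           (sym-assoc ⊙ ∘-resp-≈ˡ pb-commute ⊙ assoc
            ⊙ ∘-resp-≈ʳ (sym-assoc ⊙ ∘-resp-≈ˡ k-eq ⊙ s-section) ⊙ identityʳ)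

  id-cover : ∀ {W} → Cover (id {W})
  id-cover = ⊤-intro

  cover-∘ : ∀ {U V W} {q : V ⇒ W} {r : U ⇒ V} → Cover q → Cover r → Cover (q ∘ r)
  cover-∘ {q = q} {r} q-cover r-cover =
    descend q-cover (image (q ∘ r))
      (∈-resp-≈ (≈.sym identityˡ)
        (descend r-cover (image (q ∘ r)) (∈-resp-≈ identityʳ (image-intro (q ∘ r) id))))

  data Locally {a} {W : Obj} (P : ∀ {V} → V ⇒ W → Set a) : Set (o ⊔ ℓ ⊔ e ⊔ a) where
    locally : ∀ {V} (q : V ⇒ W) → Cover q → P q → Locally P

  locally-map : ∀ {a b W} {P : ∀ {V} → V ⇒ W → Set a} {Q : ∀ {V} → V ⇒ W → Set b} →
                (∀ {V} {q : V ⇒ W} → P q → Q q) → Locally P → Locally Q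
  locally-map f (locally q q-cover holds) = locally q q-cover (f holds)

  locally-bind : ∀ {a b W} {P : ∀ {V} → V ⇒ W → Set a} {Q : ∀ {V} → V ⇒ W → Set b} →
                 Locally P → (∀ {V} {q : V ⇒ W} → P q → Locally (λ r → Q (q ∘ r))) → Locally Q
  locally-bind (locally q q-cover holds) k with k holds
  ... | locally r r-cover holds′ = locally (q ∘ r) (cover-∘ q-cover r-cover) holds′

  locally-∈ : ∀ {W X} {x : W ⇒ X} {T : Sub X} → Locally (λ q → x ∘ q ∈ T) → x ∈ T
  locally-∈ {T = T} (locally q q-cover holds) = descend q-cover T holds

  -- Pullback-stability of images: the pullback of f along x is a cover,
  -- because x factors through im f.
  image-elim : ∀ {S X W} (f : S ⇒ X) {x : W ⇒ X} → x ∈ image f →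
               Locally (λ q → Σ (_ ⇒ S) λ s → f ∘ s ≈ x ∘ q)
  image-elim f {x} (mem h p) =
    let j , j-eq = im-stable f x
    in locally (p₂ {f = f} {x}) (mem (j ∘ pb-univ h id E) (sym-assoc ⊙ ∘-resp-≈ˡ j-eq ⊙ pb-univ₂ E))
               (p₁ , pb-commute)
    where
      E : im f ∘ h ≈ x ∘ id
      E = p ⊙ ≈.sym identityʳ

  ∃-elim : ∀ {W X Y} (f : X ⇒ Y) {P : Sub X} {y : W ⇒ Y} → y ∈ ∃⟨ f ⟩ P →
           Locally (λ q → Σ (_ ⇒ X) λ x → (x ∈ P) ∧ₜ (f ∘ x ≈ y ∘ q))
  ∃-elim f {P} y∈ =
    locally-map (λ { (s , eq) → arr P ∘ s , ∈-∘ (arr-∈ P) s , sym-assoc ⊙ eq })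
                (image-elim (f ∘ arr P) y∈)

module BeliefCycles {o ℓ e : Level} (𝒞 : RegularCategory o ℓ e) where
  open RegularCategory 𝒞
  open RegularLogic 𝒞
  open GeneralisedElements 𝒞

  data Path {W : Obj} : ∀ {X n} (ch : Chain X n) → W ⇒ X → W ⇒ end ch → Set (o ⊔ ℓ ⊔ e) where
    stop : ∀ {X} {a b : W ⇒ X} → a ≈ b → Path [] a b
    step : ∀ {X Y n} {R : Sub (X × Y)} {ch : Chain Y n} {a : W ⇒ X} {b : W ⇒ end ch}
           (y : W ⇒ Y) → ⟨ a , y ⟩ ∈ R → Path ch y b → Path (R ◁ ch) a b

  path-resp-≈ : ∀ {W X n} {ch : Chain X n} {a a′ : W ⇒ X} {b : W ⇒ end ch} →
                a ≈ a′ → Path ch a b → Path ch a′ b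
  path-resp-≈ a≈ (stop eq)       = stop (≈.sym a≈ ⊙ eq)
  path-resp-≈ a≈ (step y r path) = step y (∈-resp-≈ (⟨⟩-cong a≈ ≈.refl) r) path

  extend-sound : ∀ {Γ X n} (φ : Sub Γ) (t : Γ ⇒ X) (ch : Chain X n) {W}
                 {y : W ⇒ ctx (extend φ t ch)} → y ∈ hyp (extend φ t ch) →
                 (wk (extend φ t ch) ∘ y ∈ φ)
                 ∧ₜ Path ch (t ∘ (wk (extend φ t ch) ∘ y)) (last (extend φ t ch) ∘ y)
  extend-sound φ t [] y∈ = ∈-resp-≈ (≈.sym identityˡ) y∈ , stop (∘-resp-≈ʳ identityˡ)
  extend-sound {Γ} φ t (_◁_ {Y} R ch) {W} {y} y∈ =
    let w∈ , path = extend-sound φ₁ π₂ ch y∈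
    in ∈-resp-≈ sym-assoc (*-elim (∧-elim₁ {P = (π₁ *) φ} {Q = S} w∈))
     , step (π₂ ∘ w) (∈-resp-≈ E (*-elim (∧-elim₂ {P = (π₁ *) φ} {Q = S} w∈))) path
    where
      S φ₁ : Sub (Γ × Y)
      S  = (⟨ t ∘ π₁ , π₂ ⟩ *) R
      φ₁ = (π₁ *) φ ∧ S
      w : W ⇒ Γ × Y
      w = wk (extend φ₁ π₂ ch) ∘ y
      E : ⟨ t ∘ π₁ , π₂ ⟩ ∘ w ≈ ⟨ t ∘ ((π₁ ∘ wk (extend φ₁ π₂ ch)) ∘ y) , π₂ ∘ w ⟩
      E = ⟨⟩∘ ⊙ ⟨⟩-cong (assoc ⊙ ∘-resp-≈ʳ sym-assoc) ≈.refl

  extend-complete : ∀ {Γ X n} (φ : Sub Γ) (t : Γ ⇒ X) (ch : Chain X n) {W}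
                    {g : W ⇒ Γ} {b : W ⇒ end ch} → g ∈ φ → Path ch (t ∘ g) b →
                    Σ (W ⇒ ctx (extend φ t ch)) λ y → (y ∈ hyp (extend φ t ch))
                      ∧ₜ (wk (extend φ t ch) ∘ y ≈ g) ∧ₜ (last (extend φ t ch) ∘ y ≈ b)
  extend-complete φ t [] g∈ (stop eq) = _ , g∈ , identityˡ , eq
  extend-complete {Γ} φ t (_◁_ {Y} R ch) {g = g} g∈ (step y₁ r path) =
    let y , y∈ , wk≈ , last≈ = extend-complete φ₁ π₂ ch g₁∈ (path-resp-≈ (≈.sym project₂) path)
    in y , y∈ , (assoc ⊙ ∘-resp-≈ʳ wk≈ ⊙ project₁) , last≈
    where
      φ₁ : Sub (Γ × Y)
      φ₁ = (π₁ *) φ ∧ (⟨ t ∘ π₁ , π₂ ⟩ *) R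
      g₁∈ : ⟨ g , y₁ ⟩ ∈ φ₁
      g₁∈ = ∧-intro (*-intro (∈-resp-≈ (≈.sym project₁) g∈))
                    (*-intro (∈-resp-≈ (≈.sym first∘⟨⟩) r))

  serial-path : ∀ {Γ X n} (φ : Sub Γ) (t : Γ ⇒ X) (ch : Chain X n) → Serial φ t ch →
                ∀ {W} {g : W ⇒ Γ} → g ∈ φ →
                Locally (λ q → Σ (_ ⇒ end ch) λ b → Path ch (t ∘ (g ∘ q)) b)
  serial-path φ t [] _ g∈ = locally id id-cover (_ , stop ≈.refl)
  serial-path {Γ} φ t (_◁_ {Y} R ch) (total , serial) g∈ =
    locally-bind (∃-elim π₁ (∈-≤ g∈ total)) λ { {q = q} (w , w∈ , w≈) →
      locally-map (λ { {q = r} (b , path) → b , step (π₂ ∘ (w ∘ r)) (first-step w∈ w≈ r) path })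
        (serial-path φ₁ π₂ ch serial (∧-intro (*-intro (∈-resp-≈ (≈.sym w≈) (∈-∘ g∈ q))) w∈)) }
    where
      S φ₁ : Sub (Γ × Y)
      S  = (⟨ t ∘ π₁ , π₂ ⟩ *) R
      φ₁ = (π₁ *) φ ∧ S
      first-step : ∀ {U V W} {w : V ⇒ Γ × Y} {q : V ⇒ W} {g : W ⇒ Γ} →
                   w ∈ S → π₁ ∘ w ≈ g ∘ q → (r : U ⇒ V) → ⟨ t ∘ (g ∘ (q ∘ r)) , π₂ ∘ (w ∘ r) ⟩ ∈ R
      first-step w∈ w≈ r =
        ∈-resp-≈ (assoc ⊙ ⟨⟩∘ ⊙ ⟨⟩-cong (assoc ⊙ ∘-resp-≈ʳ (sym-assoc ⊙ ∘-resp-≈ˡ w≈ ⊙ assoc))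
                                        ≈.refl)
                 (∈-∘ (*-elim w∈) r)

  composite-intro : ∀ {A n} (ch : Chain A n) (Rlast : Sub (end ch × A)) {W} {a x : W ⇒ A}
                    {b : W ⇒ end ch} → Path ch a b → ⟨ b , x ⟩ ∈ Rlast →
                    ⟨ a , x ⟩ ∈ composite ch Rlast
  composite-intro {A} ch Rlast path r =
    let y , y∈ , wk≈ , last≈ = extend-complete ⊤ₛ id ch ⊤-intro (path-resp-≈ (≈.sym identityˡ) path)
    in ∈-resp-≈ (⟨⟩∘ ⊙ ⟨⟩-cong (∘π₁-⟨⟩ ⊙ wk≈) project₂)
         (∃-intro ⟨ wk G ∘ π₁ , π₂ ⟩
           (∧-intro (*-intro (∈-resp-≈ (≈.sym project₁) y∈))
                    (*-intro (∈-resp-≈ (≈.sym (first∘⟨⟩ ⊙ ⟨⟩-cong last≈ ≈.refl)) r))))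
    where
      G : Ext A (end ch)
      G = extend ⊤ₛ id ch

  composite-elim : ∀ {A n} (ch : Chain A n) (Rlast : Sub (end ch × A)) {W} {a x : W ⇒ A} →
                   ⟨ a , x ⟩ ∈ composite ch Rlast →
                   Locally (λ q → Σ (_ ⇒ end ch) λ b → Path ch (a ∘ q) b ∧ₜ ⟨ b , x ∘ q ⟩ ∈ Rlast)
  composite-elim {A} ch Rlast composite∈ =
    locally-map unpack (∃-elim ⟨ wk G ∘ π₁ , π₂ ⟩ composite∈)
    where
      G : Ext A (end ch)
      G = extend ⊤ₛ id ch
      QA QB : Sub (ctx G × A)
      QA = (π₁ *) (hyp G)
      QB = (⟨ last G ∘ π₁ , π₂ ⟩ *) Rlast
      unpack : ∀ {V W} {a x : W ⇒ A} {q : V ⇒ W} →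
               Σ (V ⇒ ctx G × A) (λ v → (v ∈ QA ∧ QB) ∧ₜ (⟨ wk G ∘ π₁ , π₂ ⟩ ∘ v ≈ ⟨ a , x ⟩ ∘ q)) →
               Σ (V ⇒ end ch) λ b → Path ch (a ∘ q) b ∧ₜ ⟨ b , x ∘ q ⟩ ∈ Rlast
      unpack (v , v∈ , v≈) =
        let wk≈ , π₂≈ = ⟨⟩∘-components v≈
        in last G ∘ (π₁ ∘ v)
         , path-resp-≈ (identityˡ ⊙ sym-assoc ⊙ wk≈)
             (proj₂ (extend-sound ⊤ₛ id ch (*-elim (∧-elim₁ {P = QA} {Q = QB} v∈))))
         , ∈-resp-≈ (⟨⟩∘ ⊙ ⟨⟩-cong assoc π₂≈)
             (*-elim (∧-elim₂ {P = QA} {Q = QB} v∈))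

  module Cycle {A n} (ch : Chain A n) (Rlast : Sub (end ch × A)) (c : 𝟏 ⇒ A) (p : Sub A) where
    F : Ext 𝟏 (end ch)
    F = extend ⊤ₛ c ch

    Φ Rn₁ px : Sub (ctx F × A)
    Φ   = (π₁ *) (hyp F)
    Rn₁ = (⟨ last F ∘ π₁ , π₂ ⟩ *) Rlast
    px  = (π₂ *) p

    context-point : ∀ {W} {g : W ⇒ 𝟏} {b : W ⇒ end ch} → Path ch (c ∘ g) b → (x : W ⇒ A) →
                    Σ (W ⇒ ctx F × A) λ v → (v ∈ Φ) ∧ₜ (⟨ last F ∘ π₁ , π₂ ⟩ ∘ v ≈ ⟨ b , x ⟩)
                                            ∧ₜ (π₂ ∘ v ≈ x)
    context-point path x =
      let y , y∈ , _ , last≈ = extend-complete ⊤ₛ c ch ⊤-intro path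
      in ⟨ y , x ⟩ , *-intro (∈-resp-≈ (≈.sym project₁) y∈) , first∘⟨⟩ ⊙ ⟨⟩-cong last≈ ≈.refl
       , project₂

    sequent-a : Φ ∧ Rn₁ ≤ px → ∀ {W} {g : W ⇒ 𝟏} {b : W ⇒ end ch} {x : W ⇒ A} →
                Path ch (c ∘ g) b → ⟨ b , x ⟩ ∈ Rlast → x ∈ p
    sequent-a ha path r =
      let v , v∈Φ , v-last , v-x = context-point path _
      in ∈-resp-≈ v-x (*-elim (∈-≤ (∧-intro v∈Φ (*-intro (∈-resp-≈ (≈.sym v-last) r))) ha))

    sequent-b : Φ ∧ px ≤ Rn₁ → ∀ {W} {g : W ⇒ 𝟏} {b : W ⇒ end ch} {x : W ⇒ A} →
                Path ch (c ∘ g) b → x ∈ p → ⟨ b , x ⟩ ∈ Rlast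
    sequent-b hb path x∈ =
      let v , v∈Φ , v-last , v-x = context-point path _
      in ∈-resp-≈ v-last (*-elim (∈-≤ (∧-intro v∈Φ (*-intro (∈-resp-≈ (≈.sym v-x) x∈))) hb))

    diagonal-composite-≤ : Φ ∧ Rn₁ ≤ px → (⟨ c , c ⟩ *) (composite ch Rlast) ≤ (c *) p
    diagonal-composite-≤ ha = ≤-intro λ cc∈R →
      *-intro (locally-∈ (locally-map conclude
                                      (composite-elim ch Rlast (∈-resp-≈ ⟨⟩∘ (*-elim cc∈R)))))
      where
        conclude : ∀ {V W} {z : W ⇒ 𝟏} {q : V ⇒ W} →
                   Σ (V ⇒ end ch) (λ b → Path ch ((c ∘ z) ∘ q) b ∧ₜ ⟨ b , (c ∘ z) ∘ q ⟩ ∈ Rlast) →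
                   (c ∘ z) ∘ q ∈ p
        conclude (_ , path , r) = sequent-a ha (path-resp-≈ assoc path) r

    ≤-diagonal-composite : Φ ∧ px ≤ Rn₁ → Serial ⊤ₛ c ch →
                           (c *) p ≤ (⟨ c , c ⟩ *) (composite ch Rlast)
    ≤-diagonal-composite hb hs = ≤-intro λ c∈p →
      *-intro (locally-∈ (locally-map (conclude (*-elim c∈p)) (serial-path ⊤ₛ c ch hs ⊤-intro)))
      where
        conclude : ∀ {V W} {z : W ⇒ 𝟏} {q : V ⇒ W} → c ∘ z ∈ p →
                   Σ (V ⇒ end ch) (λ b → Path ch (c ∘ (z ∘ q)) b) →
                   (⟨ c , c ⟩ ∘ z) ∘ q ∈ composite ch Rlast
        conclude {q = q} cz∈p (_ , path) =
          ∈-resp-≈ (≈.sym (assoc ⊙ ⟨⟩∘))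
            (composite-intro ch Rlast path (sequent-b hb path (∈-resp-≈ assoc (∈-∘ cz∈p q))))

lemma8 : ∀ {o ℓ e : Level} (𝒞 : RegularCategory o ℓ e) (n : ℕ)
    (A : RegularCategory.Obj 𝒞) (ch : RegularLogic.Chain 𝒞 A n)
    (Rlast : RegularCategory.Sub 𝒞 (RegularCategory._×_ 𝒞 (RegularLogic.end 𝒞 ch) A)) →
    RegularLogic.Lemma8Statement 𝒞 ch Rlast
lemma8 𝒞 n A ch Rlast belief p =
  let c , ha , hb , hs = belief p
  in c , diagonal-composite-≤ ch Rlast c p ha , ≤-diagonal-composite ch Rlast c p hb hs
  where
    open BeliefCycles.Cycle 𝒞
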